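{- Let $G$ and $H$ be finite simple connected graphs, each of order at least $4$. If $G$ is outerplanar, $P(G)=2$ and $\gamma(H)=1$, then $\gamma_P(G\Box H)=2$.
   Context: The Cartesian product $G\Box H$ has vertex set $V(G)\times V(H)$, with $(g,h)$ adjacent to $(g',h')$ iff either $g=g'$ and $hh'\in E(H)$, or $h=h'$ and $gg'\in E(G)$. $\gamma(H)$ is the domination number. The path cover number $P(G)$ is the smallest $k$ such that $V(G)$ is covered by $k$ pairwise vertex-disjoint induced paths. A graph is outerplanar if it has a crossing-free plane embedding with all vertices on the same face. Zero forcing: for $U\subseteq V(G)$ (black vertices), repeatedly apply the rule "if a black vertex has exactly one white neighbor, that neighbor becomes black"; the resulting set is the closure $cl(U)$. A set $S$ is a power dominating set if $cl(N[S])=V(G)$, where $N[S]$ is the closed neighborhood of $S$; $\gamma_P(G)$ is the minimum cardinality of a power dominating set. -}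

module Defs where

open import Level using (0ℓ)
open import Data.Nat using (ℕ; zero; suc; _≤_; _<_)
open import Data.Fin using (Fin; toℕ)
open import Data.Product using (Σ; ∃; _×_; _,_)
open import Data.Sum using (_⊎_; inj₁; inj₂)
open import Data.Empty using (⊥)
open import Data.List using (List; []; length; lookup; concat)
open import Data.List.Membership.Propositional using (_∈_)
open import Data.List.Relation.Unary.All using (All)
open import Data.List.Relation.Unary.Unique.Propositional using (Unique)
open import Relation.Binary.PropositionalEquality using (_≡_; refl)
open import Relation.Binary.Construct.Closure.ReflexiveTransitive using (Star)
open import Relation.Nullary using (¬_)
open import Function.Definitions using (Injective)

record Graph (V : Set) : Set₁ where
  field
    Adj    : V → V → Set
    sym    : ∀ {u v} → Adj u v → Adj v u
    irrefl : ∀ {v} → Adj v v → ⊥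
open Graph public

-- Finite graphs are those on Fin n; the order is n.

Connected : ∀ {V} → Graph V → Set
Connected G = ∀ u v → Star (Adj G) u v

_□_ : ∀ {A B} → Graph A → Graph B → Graph (A × B)
_□_ {A} {B} G H = record { Adj = adj ; sym = s ; irrefl = ir }
  where
  adj : A × B → A × B → Set
  adj (g , h) (g' , h') = (g ≡ g' × Adj H h h') ⊎ (h ≡ h' × Adj G g g')
  s : ∀ {u v} → adj u v → adj v u
  s (inj₁ (refl , a)) = inj₁ (refl , sym H a)
  s (inj₂ (refl , a)) = inj₂ (refl , sym G a)
  ir : ∀ {v} → adj v v → ⊥
  ir (inj₁ (_ , a)) = irrefl H a
  ir (inj₂ (_ , a)) = irrefl G a

IsMin : {A : Set} → (A → ℕ) → (A → Set) → ℕ → Set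
IsMin {A} size P k = (Σ A λ a → P a × size a ≡ k) × (∀ a → P a → k ≤ size a)

-- vertex sets are duplicate-free lists; cardinality = length
-- closed neighbourhood N[S]
InClosedNbhd : ∀ {V} → Graph V → List V → V → Set
InClosedNbhd G S v = v ∈ S ⊎ (Σ _ λ s → s ∈ S × Adj G s v)

Dominating : ∀ {V} → Graph V → List V → Set
Dominating G S = ∀ v → InClosedNbhd G S v

DominationNumber : ∀ {V} → Graph V → ℕ → Set
DominationNumber G = IsMin length (λ S → Unique S × Dominating G S)

-- zero-forcing closure cl(U) of a set U (given as a predicate):
-- the least set containing U and closed under the forcing rule
data InCl {V : Set} (G : Graph V) (U : V → Set) : V → Set where
  base  : ∀ {v} → U v → InCl G U v
  force : ∀ {u w} → InCl G U u → Adj G u w →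
          (∀ x → Adj G u x → ¬ (x ≡ w) → InCl G U x) → InCl G U w

PowerDominating : ∀ {V} → Graph V → List V → Set
PowerDominating G S = ∀ v → InCl G (InClosedNbhd G S) v

PowerDominationNumber : ∀ {V} → Graph V → ℕ → Set
PowerDominationNumber G = IsMin length (λ S → Unique S × PowerDominating G S)

IsInducedPath : ∀ {V} → Graph V → List V → Set
IsInducedPath G p =
  ¬ (p ≡ []) × Unique p ×
  (∀ i j → (Adj G (lookup p i) (lookup p j) →
              (toℕ i ≡ suc (toℕ j) ⊎ toℕ j ≡ suc (toℕ i)))
         × ((toℕ i ≡ suc (toℕ j) ⊎ toℕ j ≡ suc (toℕ i)) →
              Adj G (lookup p i) (lookup p j)))

IsInducedPathCover : ∀ {V} → Graph V → List (List V) → Set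
IsInducedPathCover G ps =
  All (IsInducedPath G) ps × Unique (concat ps) × (∀ v → v ∈ concat ps)

PathCoverNumber : ∀ {V} → Graph V → ℕ → Set
PathCoverNumber G = IsMin length (IsInducedPathCover G)

-- Outerplanar: vertices placed at distinct positions on a circle
-- (cyclic order given by an injective position map) with edges drawn
-- as chords, no two chords crossing.
Outerplanar : ∀ {n} → Graph (Fin n) → Set
Outerplanar {n} G =
  Σ (Fin n → ℕ) λ pos → Injective _≡_ _≡_ pos ×
    (∀ a b c d → Adj G a b → Adj G c d →
       ¬ (pos a < pos c × pos c < pos b × pos b < pos d))

{-# OPTIONS --safe #-}
module Submission where

-- Cover G by two induced paths p 0 … p (a-1) and q 0 … q (b-1) and call an edge
-- p i q j a rung.  In an outerplanar embedding the cyclic orientation of p i, p k and Q is the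
-- same for all i < k whose vertices see Q along a chord that no edge of P crosses, and likewise
-- for Q.  Two rungs p i q j, p k q l with i < k and j < l force these two orientations to be
-- opposite, with i < k and l < j to be equal; so only one kind occurs and, after reversing Q if
-- necessary, the rungs are monotone.  Then {p 0, q 0} is zero forcing: whenever the black
-- prefixes p 0 … p i and q 0 … q j cannot be extended, p i and q j would have rungs into each
-- other's white part, which is a non-monotone pair.  If d dominates H, N[{(p 0, d), (q 0, d)}]
-- contains both fibres {p 0} × H and {q 0} × H, and forcing in G lifts fibrewise.
--
-- Forcing from a single vertex g of G traces an induced path, which would cover G
-- if {g} were zero forcing, contradicting P(G) = 2; in H a dominating vertex with at least three
-- neighbours keeps the closure of {h} inside {h, d}.  So V(G) ∖ cl{g} and V(H) ∖ cl{h} are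
-- nonempty forts, and their product is a fort of G □ H avoiding N[(g, h)].

open import Defs hiding (sym; irrefl)
open Graph using () renaming (sym to adj-sym; irrefl to adj-irrefl)
open import Data.Bool using (Bool; true; false; not; _∧_; _∨_; _xor_; T)
open import Data.Bool.Properties using (∨-assoc; ∨-comm; T-≡; T-∧; not-¬)
import Data.Bool.Properties as Bool
open import Data.Empty using (⊥; ⊥-elim)
open import Data.Fin using (Fin; zero; suc; toℕ; fromℕ<)
open import Data.Fin.Patterns using (0F; 1F; 2F; 3F)
open import Data.Fin.Properties
  using (all?; any?; ¬∀⟶∃¬; injective⇒≤; toℕ<n; toℕ-injective; toℕ-fromℕ<; fromℕ<-injective)
import Data.Fin.Properties as Fin
open import Data.Fin.Subset using (Subset)
import Data.Fin.Subset as Subset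
open import Data.Fin.Subset.Properties using (p⊂q⇒∣p∣<∣q∣; ∣⊤∣≡n; ∈⊤)
open import Data.List using (List; []; _∷_; _++_; length; lookup; map; applyUpTo)
open import Data.List.Properties using (length-applyUpTo; lookup-applyUpTo; ++-identityʳ)
open import Data.List.Membership.Propositional using (_∈_; _∉_)
open import Data.List.Membership.Propositional.Properties
  using (∈-lookup; ∈-map⁺; ∈-applyUpTo⁺; ∈-++⁺ˡ; ∈-++⁺ʳ; ∈-++⁻)
open import Data.List.Relation.Unary.All using ([]; _∷_)
import Data.List.Relation.Unary.All as All
open import Data.List.Relation.Unary.AllPairs using ([]; _∷_)
open import Data.List.Relation.Unary.Any using (here; there; index)
import Data.List.Relation.Unary.Any as Any
open import Data.List.Relation.Unary.Any.Properties using (lookup-index)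
open import Data.List.Relation.Unary.Unique.Propositional using (Unique)
open import Data.List.Relation.Unary.Unique.Propositional.Properties using (map⁺; applyUpTo⁺₁)
open import Data.Nat using (ℕ; zero; suc; pred; _+_; _∸_; _<_; _≤_; _<ᵇ_; _<?_; _≤?_; _⊓_; _⊔_; z≤n; s≤s)
open import Data.Nat.Properties
open import Data.Product using (Σ; ∃; ∃₂; _×_; _,_; proj₁; proj₂)
open import Data.Sum using (_⊎_; inj₁; inj₂; [_,_]′)
import Data.Sum as Sum
open import Data.Vec using (Vec; []; _∷_)
import Data.Vec as Vec
open import Data.Vec.Properties using (lookup∘tabulate; []=⇒lookup; lookup⇒[]=)
open import Function using (_∘_)
open import Function.Bundles using (Equivalence)
open import Function.Definitions using (Injective)
open import Relation.Binary.Definitions using (tri<; tri≈; tri>)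
open import Relation.Binary.PropositionalEquality
  using (_≡_; _≢_; refl; sym; trans; cong; cong₂; subst; subst₂; ≢-sym; module ≡-Reasoning)
open import Relation.Nullary using (¬_; Dec; yes; no; contradiction)
open import Relation.Nullary.Decidable using (map′; _→-dec_; _×-dec_; ¬?; T?; True; toWitness)
open import Relation.Nullary.Decidable.Core using (¬¬-excluded-middle)
open import Relation.Nullary.Reflects using (det; fromEquivalence)

-- Order types of finitely many naturals

infix  7 _≺_
infix  6 ¬′_
infixr 5 _∧′_
infixr 4 _∨′_
infixr 3 _⇔′_
infixr 2 _⇒′_

data Formula (k : ℕ) : Set where
  _≺_ : Fin k → Fin k → Formula k
  ¬′_ : Formula k → Formula k
  _∧′_ _∨′_ _⇒′_ _⇔′_ : Formula k → Formula k → Formula k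

_⇔ᵇ_ : Bool → Bool → Bool
x ⇔ᵇ y = not (x xor y)

⟦_⟧ : ∀ {k} → Formula k → (Fin k → ℕ) → Bool
⟦ i ≺ j ⟧   v = v i <ᵇ v j
⟦ ¬′ φ ⟧    v = not (⟦ φ ⟧ v)
⟦ φ ∧′ ψ ⟧ v = ⟦ φ ⟧ v ∧ ⟦ ψ ⟧ v
⟦ φ ∨′ ψ ⟧ v = ⟦ φ ⟧ v ∨ ⟦ ψ ⟧ v
⟦ φ ⇒′ ψ ⟧ v = not (⟦ φ ⟧ v) ∨ ⟦ ψ ⟧ v
⟦ φ ⇔′ ψ ⟧ v = ⟦ φ ⟧ v ⇔ᵇ ⟦ ψ ⟧ v

⟦⟧-cong : ∀ {k} (φ : Formula k) {v w : Fin k → ℕ} →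
          (∀ i j → (v i <ᵇ v j) ≡ (w i <ᵇ w j)) → ⟦ φ ⟧ v ≡ ⟦ φ ⟧ w
⟦⟧-cong (i ≺ j)   same = same i j
⟦⟧-cong (¬′ φ)    same = cong not (⟦⟧-cong φ same)
⟦⟧-cong (φ ∧′ ψ) same = cong₂ _∧_ (⟦⟧-cong φ same) (⟦⟧-cong ψ same)
⟦⟧-cong (φ ∨′ ψ) same = cong₂ _∨_ (⟦⟧-cong φ same) (⟦⟧-cong ψ same)
⟦⟧-cong (φ ⇒′ ψ) same = cong₂ (λ x y → not x ∨ y) (⟦⟧-cong φ same) (⟦⟧-cong ψ same)
⟦⟧-cong (φ ⇔′ ψ) same = cong₂ _⇔ᵇ_ (⟦⟧-cong φ same) (⟦⟧-cong ψ same)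

⇔ᵇ-≡ : ∀ {x y} → T (x ⇔ᵇ y) → x ≡ y
⇔ᵇ-≡ {true}  {true}  _ = refl
⇔ᵇ-≡ {false} {false} _ = refl

≡-⇔ᵇ : ∀ {x y} → x ≡ y → T (x ⇔ᵇ y)
≡-⇔ᵇ {true}  refl = _
≡-⇔ᵇ {false} refl = _

⇒ᵇ-mp : ∀ {x y} → T (not x ∨ y) → T x → T y
⇒ᵇ-mp {true} ty _ = ty

Valid : ∀ {k} → Formula k → Set
Valid φ = ∀ v → Injective _≡_ _≡_ v → T (⟦ φ ⟧ v)

-- Replacing each value of an injective valuation by its rank gives a valuation into Fin k with
-- the same comparisons, so validity only has to be checked on injective maps Fin k → Fin k.
module _ {k : ℕ} (v : Fin k → ℕ) where

  below : Fin k → Subset k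
  below i = Vec.tabulate λ j → v j <ᵇ v i

  below⁺ : ∀ {i j} → v j < v i → j Subset.∈ below i
  below⁺ {i} {j} vj<vi = lookup⇒[]= j (below i) (trans (lookup∘tabulate _ j) (Equivalence.to T-≡ (<⇒<ᵇ vj<vi)))

  below⁻ : ∀ {i j} → j Subset.∈ below i → v j < v i
  below⁻ {i} {j} j∈ = <ᵇ⇒< (v j) (v i) (Equivalence.from T-≡ (trans (sym (lookup∘tabulate _ j)) ([]=⇒lookup j∈)))

  below-⊂ : ∀ {i j} → v i < v j → below i Subset.⊂ below j
  below-⊂ {i} vi<vj = (λ l∈ → below⁺ (<-trans (below⁻ l∈) vi<vj)) , i , below⁺ vi<vj , λ i∈ → <-irrefl refl (below⁻ i∈)

  rank : Fin k → Fin k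
  rank i = fromℕ< (<-≤-trans (p⊂q⇒∣p∣<∣q∣ below⊂⊤) (≤-reflexive (∣⊤∣≡n k)))
    where
    below⊂⊤ : below i Subset.⊂ Subset.⊤
    below⊂⊤ = (λ _ → ∈⊤) , i , ∈⊤ , λ i∈ → <-irrefl refl (below⁻ i∈)

  rank-mono : ∀ {i j} → v i < v j → toℕ (rank i) < toℕ (rank j)
  rank-mono {i} {j} vi<vj = subst₂ _<_ (sym (toℕ-fromℕ< _)) (sym (toℕ-fromℕ< _)) (p⊂q⇒∣p∣<∣q∣ (below-⊂ vi<vj))

  module _ (v-injective : Injective _≡_ _≡_ v) where

    rank-reflects : ∀ {i j} → toℕ (rank i) < toℕ (rank j) → v i < v j
    rank-reflects {i} {j} ri<rj with <-cmp (v i) (v j)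
    ... | tri< vi<vj _ _ = vi<vj
    ... | tri≈ _ vi≡vj _ rewrite v-injective vi≡vj = contradiction ri<rj (<-irrefl refl)
    ... | tri> _ _ vj<vi = contradiction ri<rj (<-asym (rank-mono vj<vi))

    rank-<ᵇ : ∀ i j → (v i <ᵇ v j) ≡ (toℕ (rank i) <ᵇ toℕ (rank j))
    rank-<ᵇ i j = det (<ᵇ-reflects-< (v i) (v j)) (fromEquivalence (rank-reflects ∘ <ᵇ⇒< _ _) (<⇒<ᵇ ∘ rank-mono))

    rank-injective : Injective _≡_ _≡_ rank
    rank-injective {i} {j} eq with <-cmp (v i) (v j)
    ... | tri< vi<vj _ _ = contradiction (cong toℕ eq) (<⇒≢ (rank-mono vi<vj))
    ... | tri≈ _ vi≡vj _ = v-injective vi≡vj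
    ... | tri> _ _ vj<vi = contradiction (cong toℕ eq) (≢-sym (<⇒≢ (rank-mono vj<vi)))

injective? : ∀ {k m} (f : Fin k → Fin m) → Dec (Injective _≡_ _≡_ f)
injective? f = map′ (λ h {i} {j} → h i j) (λ h i j → h) (all? λ i → all? λ j → (f i Fin.≟ f j) →-dec (i Fin.≟ j))

∀-vec? : ∀ {k m} {P : Vec (Fin m) k → Set} → (∀ xs → Dec (P xs)) → Dec (∀ xs → P xs)
∀-vec? {zero}  P? = map′ (λ p → λ { [] → p }) (λ h → h []) (P? [])
∀-vec? {suc k} P? =
  map′ (λ h → λ { (x ∷ xs) → h x xs }) (λ h x xs → h (x ∷ xs)) (all? λ x → ∀-vec? λ xs → P? (x ∷ xs))

ValidOnRanks : ∀ {k} → Formula k → Set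
ValidOnRanks {k} φ = ∀ (r : Vec (Fin k) k) → Injective _≡_ _≡_ (Vec.lookup r) → T (⟦ φ ⟧ (toℕ ∘ Vec.lookup r))

validOnRanks? : ∀ {k} (φ : Formula k) → Dec (ValidOnRanks φ)
validOnRanks? φ = ∀-vec? λ r → injective? (Vec.lookup r) →-dec T? (⟦ φ ⟧ (toℕ ∘ Vec.lookup r))

valid : ∀ {k} (φ : Formula k) → ValidOnRanks φ → Valid φ
valid φ on-ranks v v-injective = subst T (sym (⟦⟧-cong φ same)) (on-ranks r r-injective)
  where
  r = Vec.tabulate (rank v)
  lookup-r : ∀ i → Vec.lookup r i ≡ rank v i
  lookup-r = lookup∘tabulate (rank v)
  same : ∀ i j → (v i <ᵇ v j) ≡ (toℕ (Vec.lookup r i) <ᵇ toℕ (Vec.lookup r j))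
  same i j = trans (rank-<ᵇ v v-injective i j) (sym (cong₂ (λ x y → toℕ x <ᵇ toℕ y) (lookup-r i) (lookup-r j)))
  r-injective : Injective _≡_ _≡_ (Vec.lookup r)
  r-injective {i} {j} eq = rank-injective v v-injective (trans (sym (lookup-r i)) (trans eq (lookup-r j)))

decide : ∀ {k} (φ : Formula k) → {True (validOnRanks? φ)} → Valid φ
decide φ {ok} = valid φ (toWitness ok)

lookup-injective : ∀ {A : Set} {xs : List A} → Unique xs → Injective _≡_ _≡_ (lookup xs)
lookup-injective {xs = x ∷ xs} (x∉xs ∷ _) {zero}  {zero}  _  = refl
lookup-injective {xs = x ∷ xs} (x∉xs ∷ _) {zero}  {suc j} eq = contradiction eq (All.lookup x∉xs (∈-lookup j))
lookup-injective {xs = x ∷ xs} (x∉xs ∷ _) {suc i} {zero}  eq = contradiction (sym eq) (All.lookup x∉xs (∈-lookup i))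
lookup-injective {xs = x ∷ xs} (_ ∷ u)    {suc i} {suc j} eq = cong suc (lookup-injective u eq)

-- Positions in ℕ are read cyclically: ori a b c holds when a, b, c occur in this cyclic order.
ori : ℕ → ℕ → ℕ → Bool
ori a b c = ((a <ᵇ b) ∧ (b <ᵇ c)) ∨ ((b <ᵇ c) ∧ (c <ᵇ a)) ∨ ((c <ᵇ a) ∧ (a <ᵇ b))

interleaves : ℕ → ℕ → ℕ → ℕ → Bool
interleaves a c b d = (a <ᵇ c) ∧ (c <ᵇ b) ∧ (b <ᵇ d)

crosses : ℕ → ℕ → ℕ → ℕ → Bool
crosses a b c d =
  interleaves a c b d ∨ interleaves b c a d ∨ interleaves a d b c ∨ interleaves b d a c ∨
  interleaves c a d b ∨ interleaves d a c b ∨ interleaves c b d a ∨ interleaves d b c a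

private
  Ori : ∀ {k} → Fin k → Fin k → Fin k → Formula k
  Ori a b c = (a ≺ b ∧′ b ≺ c) ∨′ (b ≺ c ∧′ c ≺ a) ∨′ (c ≺ a ∧′ a ≺ b)

  Interleaves : ∀ {k} → Fin k → Fin k → Fin k → Fin k → Formula k
  Interleaves a c b d = a ≺ c ∧′ c ≺ b ∧′ b ≺ d

  Crosses : ∀ {k} → Fin k → Fin k → Fin k → Fin k → Formula k
  Crosses a b c d =
    Interleaves a c b d ∨′ Interleaves b c a d ∨′ Interleaves a d b c ∨′ Interleaves b d a c ∨′
    Interleaves c a d b ∨′ Interleaves d a c b ∨′ Interleaves c b d a ∨′ Interleaves d b c a

¬T⇒T-not : ∀ {x} → ¬ T x → T (not x)
¬T⇒T-not {true}  ¬tx = ¬tx _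
¬T⇒T-not {false} _   = _

T-not-∨ : ∀ {x y} → T (not x) → T (not y) → T (not (x ∨ y))
T-not-∨ {false} _ t = t

not-interleaves : ∀ {a c b d} → ¬ (a < c × c < b × b < d) → T (not (interleaves a c b d))
not-interleaves {a} {c} {b} {d} ¬interleaved = ¬T⇒T-not λ t →
  let (a<c , t′) = Equivalence.to T-∧ t
      (c<b , b<d) = Equivalence.to T-∧ t′
  in ¬interleaved (<ᵇ⇒< a c a<c , <ᵇ⇒< c b c<b , <ᵇ⇒< b d b<d)

ori-rotate : ∀ a b c → ori a b c ≡ ori b c a
ori-rotate a b c = trans (∨-comm x (y ∨ z)) (∨-assoc y z x)
  where
  x = (a <ᵇ b) ∧ (b <ᵇ c)
  y = (b <ᵇ c) ∧ (c <ᵇ a)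
  z = (c <ᵇ a) ∧ (a <ᵇ b)

ori-swap : ∀ {a b c} → Unique (a ∷ b ∷ c ∷ []) → ori a c b ≡ not (ori a b c)
ori-swap {a} {b} {c} u = ⇔ᵇ-≡
  (decide (Ori 0F 2F 1F ⇔′ ¬′ Ori 0F 1F 2F) (lookup (a ∷ b ∷ c ∷ [])) (lookup-injective u))

ori-uncrossed : ∀ {a b c d} → Unique (a ∷ b ∷ c ∷ d ∷ []) → T (not (crosses a b c d)) → ori a b c ≡ ori a b d
ori-uncrossed {a} {b} {c} {d} u uncrossed = ⇔ᵇ-≡ (⇒ᵇ-mp
  (decide (¬′ Crosses 0F 1F 2F 3F ⇒′ (Ori 0F 1F 2F ⇔′ Ori 0F 1F 3F))
          (lookup (a ∷ b ∷ c ∷ d ∷ [])) (lookup-injective u))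
  uncrossed)

ori-separation-sym : ∀ {a b x y} → Unique (a ∷ b ∷ x ∷ y ∷ []) → ori x y a ≡ ori x y b → ori a b x ≡ ori a b y
ori-separation-sym {a} {b} {x} {y} u same = ⇔ᵇ-≡ (⇒ᵇ-mp
  (decide ((Ori 2F 3F 0F ⇔′ Ori 2F 3F 1F) ⇒′ (Ori 0F 1F 2F ⇔′ Ori 0F 1F 3F))
          (lookup (a ∷ b ∷ x ∷ y ∷ [])) (lookup-injective u))
  (≡-⇔ᵇ same))

ori-across : ∀ {a b c d} → Unique (a ∷ b ∷ c ∷ d ∷ []) → ori a c b ≡ ori a c d → ori a b c ≡ ori d c a
ori-across {a} {b} {c} {d} u same = ⇔ᵇ-≡ (⇒ᵇ-mp
  (decide ((Ori 0F 2F 1F ⇔′ Ori 0F 2F 3F) ⇒′ (Ori 0F 1F 2F ⇔′ Ori 3F 2F 0F))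
          (lookup (a ∷ b ∷ c ∷ d ∷ [])) (lookup-injective u))
  (≡-⇔ᵇ same))

stepwise-≡ : ∀ {A : Set} (f : ℕ → A) {s t} → s ≤ t → (∀ {r} → s ≤ r → r < t → f r ≡ f (suc r)) → f s ≡ f t
stepwise-≡ f {t = zero}  z≤n _    = refl
stepwise-≡ f {t = suc t} s≤t step with m≤n⇒m<n∨m≡n s≤t
... | inj₁ s<1+t =
  trans (stepwise-≡ f (≤-pred s<1+t) λ s≤r r<t → step s≤r (m≤n⇒m≤1+n r<t)) (step (≤-pred s<1+t) ≤-refl)
... | inj₂ refl  = refl

module Mirror (len : ℕ) where

  mirror : ℕ → ℕ
  mirror i = len ∸ suc i

  mirror-< : ∀ {i} → i < len → mirror i < len
  mirror-< {i} (s≤s i≤l) = s≤s (m∸n≤m _ i)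

  mirror-suc : ∀ {i} → suc i < len → suc (mirror (suc i)) ≡ mirror i
  mirror-suc 2+i≤len = sym (+-∸-assoc 1 2+i≤len)

  mirror-injective : ∀ {i j} → i < len → j < len → mirror i ≡ mirror j → i ≡ j
  mirror-injective i<len j<len eq = cong pred (∸-cancelˡ-≡ i<len j<len eq)

  mirror-involutive : ∀ {i} → i < len → mirror (mirror i) ≡ i
  mirror-involutive i<len = trans (cong (len ∸_) (sym (+-∸-assoc 1 i<len))) (m∸[m∸n]≡n (<⇒≤ i<len))

  mirror-reverses : ∀ {i j} → i < j → j < len → mirror j < mirror i
  mirror-reverses i<j j<len = ∸-monoʳ-< (s≤s i<j) j<len

  mirror-step : ∀ {i j} → i < len → j < len → mirror j ≡ suc (mirror i) → i ≡ suc j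
  mirror-step {i} {j} i<len j<len eq =
    sym (mirror-injective 1+j<len i<len (suc-injective (trans (mirror-suc 1+j<len) eq)))
    where
    1+j<len : suc j < len
    1+j<len = m∸n≢0⇒n<m λ eq0 → 0≢1+n (trans (sym eq0) eq)

module _ {n : ℕ} (G : Graph (Fin n)) where

  record Path (len : ℕ) : Set where
    field
      at        : ℕ → Fin n
      injective : ∀ {i j} → i < len → j < len → at i ≡ at j → i ≡ j
      adjacent  : ∀ {i} → suc i < len → Adj G (at i) (at (suc i))

open Path

module _ {n : ℕ} (G : Graph (Fin n)) where

  Induced : ∀ {len} → Path G len → Set
  Induced {len} P = ∀ {i j} → i < len → j < len → Adj G (at P i) (at P j) → j ≡ suc i ⊎ i ≡ suc j

  Monotone : ∀ {a b} → Path G a → Path G b → Set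
  Monotone {a} {b} P Q = ∀ {i j k l} → i < a → j < b → k < a → l < b →
    Adj G (at P i) (at Q j) → Adj G (at P k) (at Q l) → i < k → j ≤ l

  module _ {len : ℕ} where
    open Mirror len

    reverse : Path G len → Path G len
    reverse P = record
      { at        = λ i → at P (mirror i)
      ; injective = λ i<len j<len eq → mirror-injective i<len j<len (injective P (mirror-< i<len) (mirror-< j<len) eq)
      ; adjacent  = λ {i} 1+i<len → adj-sym G
                      (subst (λ k → Adj G (at P (mirror (suc i))) (at P k)) (mirror-suc 1+i<len)
                        (adjacent P (subst (_< len) (sym (mirror-suc 1+i<len)) (mirror-< (<-trans (n<1+n i) 1+i<len)))))
      }

    reverse-induced : {P : Path G len} → Induced P → Induced (reverse P)
    reverse-induced induced i<len j<len adj with induced (mirror-< i<len) (mirror-< j<len) adj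
    ... | inj₁ eq = inj₂ (mirror-step i<len j<len eq)
    ... | inj₂ eq = inj₁ (mirror-step j<len i<len eq)

  record TwoPathCover (a b : ℕ) : Set where
    field
      P         : Path G a
      Q         : Path G b
      P-induced : Induced P
      Q-induced : Induced Q
      disjoint  : ∀ {i j} → i < a → j < b → at P i ≢ at Q j
      covers    : ∀ v → (∃ λ i → i < a × at P i ≡ v) ⊎ (∃ λ j → j < b × at Q j ≡ v)

  swap : ∀ {a b} → TwoPathCover a b → TwoPathCover b a
  swap C = record
    { P = Q ; Q = P ; P-induced = Q-induced ; Q-induced = P-induced
    ; disjoint = λ j<b i<a → ≢-sym (disjoint i<a j<b)
    ; covers = λ v → [ inj₂ , inj₁ ]′ (covers v) }
    where open TwoPathCover C

  reverse-Q : ∀ {a b} → TwoPathCover a b → TwoPathCover a b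
  reverse-Q {a} {b} C = record
    { P = P ; Q = reverse Q ; P-induced = P-induced ; Q-induced = reverse-induced {P = Q} Q-induced
    ; disjoint = λ i<a j<b → disjoint i<a (mirror-< j<b)
    ; covers = λ v → [ inj₁ , inj₂ ∘ mirrored ]′ (covers v) }
    where
    open TwoPathCover C
    open Mirror b
    mirrored : ∀ {v} → (∃ λ j → j < b × at Q j ≡ v) → ∃ λ j → j < b × at Q (mirror j) ≡ v
    mirrored (j , j<b , eq) = mirror j , mirror-< j<b , trans (cong (at Q) (mirror-involutive j<b)) eq

distinct₃ : ∀ {A : Set} {x y z : A} → x ≢ y → x ≢ z → y ≢ z → Unique (x ∷ y ∷ z ∷ [])
distinct₃ x≢y x≢z y≢z = (x≢y ∷ x≢z ∷ []) ∷ (y≢z ∷ []) ∷ [] ∷ []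

distinct₄ : ∀ {A : Set} {x y z w : A} → x ≢ y → x ≢ z → x ≢ w → y ≢ z → y ≢ w → z ≢ w → Unique (x ∷ y ∷ z ∷ w ∷ [])
distinct₄ x≢y x≢z x≢w y≢z y≢w z≢w = (x≢y ∷ x≢z ∷ x≢w ∷ []) ∷ (y≢z ∷ y≢w ∷ []) ∷ (z≢w ∷ []) ∷ [] ∷ []

module _ {n : ℕ} {G : Graph (Fin n)} where

  at-distinct : ∀ {len} (R : Path G len) {i j} → i < len → j < len → i ≢ j → at R i ≢ at R j
  at-distinct R i<len j<len i≢j eq = i≢j (injective R i<len j<len eq)

  adjacent-distinct : ∀ {len} (R : Path G len) {i} → suc i < len → at R i ≢ at R (suc i)
  adjacent-distinct R 1+i<len = at-distinct R (<-trans (n<1+n _) 1+i<len) 1+i<len (≢-sym 1+n≢n)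

Adj⇒≢ : ∀ {n} (G : Graph (Fin n)) {x y} → Adj G x y → x ≢ y
Adj⇒≢ G adj refl = adj-irrefl G adj

-- Outerplanar embeddings

module Embedded {n : ℕ} (G : Graph (Fin n)) (pos : Fin n → ℕ) (pos-injective : Injective _≡_ _≡_ pos)
  (planar : ∀ a b c d → Adj G a b → Adj G c d → ¬ (pos a < pos c × pos c < pos b × pos b < pos d)) where

  side : Fin n → Fin n → Fin n → Bool
  side x y z = ori (pos x) (pos y) (pos z)

  private
    distinct : ∀ {xs} → Unique xs → Unique (map pos xs)
    distinct = map⁺ pos-injective

  side-rotate : ∀ x y z → side x y z ≡ side y z x
  side-rotate x y z = ori-rotate (pos x) (pos y) (pos z)

  side-swap : ∀ {x y z} → Unique (x ∷ y ∷ z ∷ []) → side x z y ≡ not (side x y z)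
  side-swap u = ori-swap (distinct u)

  side-flip : ∀ {x y z} → Unique (x ∷ y ∷ z ∷ []) → side y x z ≡ not (side x y z)
  side-flip {x} {y} {z} u = trans (side-rotate y x z) (side-swap u)

  side-across : ∀ {a b c d} → Unique (a ∷ b ∷ c ∷ d ∷ []) → side a c b ≡ side a c d → side a b c ≡ side d c a
  side-across u = ori-across (distinct u)

  side-separation-sym : ∀ {a b x y} → Unique (a ∷ b ∷ x ∷ y ∷ []) → side x y a ≡ side x y b → side a b x ≡ side a b y
  side-separation-sym u = ori-separation-sym (distinct u)

  edges-uncrossed : ∀ {a b c d} → Adj G a b → Adj G c d → T (not (crosses (pos a) (pos b) (pos c) (pos d)))
  edges-uncrossed {a} {b} {c} {d} e f =
    T-not-∨ (not-interleaves (planar a b c d e f)) (T-not-∨ (not-interleaves (planar b a c d e′ f))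
    (T-not-∨ (not-interleaves (planar a b d c e f′)) (T-not-∨ (not-interleaves (planar b a d c e′ f′))
    (T-not-∨ (not-interleaves (planar c d a b f e)) (T-not-∨ (not-interleaves (planar d c a b f′ e))
    (T-not-∨ (not-interleaves (planar c d b a f e′)) (not-interleaves (planar d c b a f′ e′))))))))
    where
    e′ = adj-sym G e
    f′ = adj-sym G f

  edge-side : ∀ {x y c d} → Adj G x y → Adj G c d → Unique (x ∷ y ∷ c ∷ d ∷ []) → side x y c ≡ side x y d
  edge-side e f u = ori-uncrossed (distinct u) (edges-uncrossed e f)

  -- No edge of R crosses the chord xy (edges at x excepted).
  Uncrossed : ∀ {len} → Path G len → Fin n → Fin n → Set
  Uncrossed {len} R x y =
    ∀ {r} → suc r < len → x ≢ at R r → x ≢ at R (suc r) → side x y (at R r) ≡ side x y (at R (suc r))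

  edge-uncrossed : ∀ {len} (R : Path G len) {x y} → Adj G x y → (∀ {r} → r < len → y ≢ at R r) → Uncrossed R x y
  edge-uncrossed R xy y∉R 1+r<len x≢r x≢1+r = edge-side xy (adjacent R 1+r<len)
    (distinct₄ (Adj⇒≢ G xy) x≢r x≢1+r (y∉R (<-trans (n<1+n _) 1+r<len)) (y∉R 1+r<len) (adjacent-distinct R 1+r<len))

  segment-side : ∀ {len} (R : Path G len) {x y s t} → Uncrossed R x y → s ≤ t → t < len →
                 (∀ {r} → s ≤ r → r ≤ t → x ≢ at R r) → side x y (at R s) ≡ side x y (at R t)
  segment-side R {x} {y} uncrossed s≤t t<len x∉R = stepwise-≡ (λ r → side x y (at R r)) s≤t λ s≤r r<t →
    uncrossed (≤-<-trans r<t t<len) (x∉R s≤r (<⇒≤ r<t)) (x∉R (m≤n⇒m≤1+n s≤r) r<t)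

  path-side : ∀ {len} (R : Path G len) {x y s t} → Uncrossed R x y → (∀ {r} → r < len → x ≢ at R r) →
              s < len → t < len → side x y (at R s) ≡ side x y (at R t)
  path-side R uncrossed x∉R s<len t<len = trans
    (sym (segment-side R uncrossed z≤n s<len λ _ r≤s → x∉R (≤-<-trans r≤s s<len)))
    (segment-side R uncrossed z≤n t<len λ _ r≤t → x∉R (≤-<-trans r≤t t<len))

  Uncrossed? : ∀ {len} (R : Path G len) x y → Dec (Uncrossed R x y)
  Uncrossed? {len} R x y = map′ to (λ h _ → h) (allUpTo? step? len)
    where
    Step : ℕ → Set
    Step r = suc r < len → x ≢ at R r → x ≢ at R (suc r) → side x y (at R r) ≡ side x y (at R (suc r))
    step? : ∀ r → Dec (Step r)
    step? r = suc r <? len →-dec ¬? (x Fin.≟ at R r) →-dec ¬? (x Fin.≟ at R (suc r)) →-dec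
              side x y (at R r) Bool.≟ side x y (at R (suc r))
    to : (∀ {r} → r < len → Step r) → Uncrossed R x y
    to h {r} 1+r<len = h (<-trans (n<1+n r) 1+r<len) 1+r<len

  module Orientation {a b} (P : Path G a) (Q : Path G b) (disjoint : ∀ {i j} → i < a → j < b → at P i ≢ at Q j) where

    private
      p = at P
      q = at Q

    Exposed : ℕ → Set
    Exposed i = ∃ λ j → j < b × Uncrossed P (p i) (q j)

    Q-on-one-side : ∀ {s t u} → s < a → t < a → s ≢ t → u < b → side (p s) (p t) (q u) ≡ side (p s) (p t) (q 0)
    Q-on-one-side {s} {t} {u} s<a t<a s≢t u<b = sym (stepwise-≡ (λ r → side (p s) (p t) (q r)) z≤n step)
      where
      step : ∀ {r} → 0 ≤ r → r < u → side (p s) (p t) (q r) ≡ side (p s) (p t) (q (suc r))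
      step {r} _ r<u = side-separation-sym
        (distinct₄ (at-distinct P s<a t<a s≢t) (disjoint s<a r<b) (disjoint s<a 1+r<b)
                   (disjoint t<a r<b) (disjoint t<a 1+r<b) (adjacent-distinct Q 1+r<b))
        (path-side P (edge-uncrossed P (adjacent Q 1+r<b) λ r′<a → ≢-sym (disjoint r′<a 1+r<b))
                     (λ r′<a → ≢-sym (disjoint r′<a r<b)) s<a t<a)
        where
        1+r<b = ≤-<-trans r<u u<b
        r<b = <-trans (n<1+n r) 1+r<b

    orientation : ℕ → ℕ → Bool
    orientation i k = side (p i) (p k) (q 0)

    orientation-triple : ∀ {i k m} → i < k → k < m → m < a → Exposed i → Exposed m →
                         orientation i k ≡ orientation i m × orientation i m ≡ orientation k m
    orientation-triple {i} {k} {m} i<k k<m m<a (j , j<b , i-uncrossed) (l , l<b , m-uncrossed) = left , right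
      where
      open ≡-Reasoning
      k<a = <-trans k<m m<a
      i<a = <-trans i<k k<a
      pi≢pk = at-distinct P i<a k<a (<⇒≢ i<k)
      pi≢pm = at-distinct P i<a m<a (<⇒≢ (<-trans i<k k<m))
      left : orientation i k ≡ orientation i m
      left = begin
        side (p i) (p k) (q 0)    ≡⟨ sym (Q-on-one-side i<a k<a (<⇒≢ i<k) j<b) ⟩
        side (p i) (p k) (q j)    ≡⟨ side-swap (distinct₃ (disjoint i<a j<b) pi≢pk (≢-sym (disjoint k<a j<b))) ⟩
        not (side (p i) (q j) (p k)) ≡⟨ cong not (segment-side P i-uncrossed (<⇒≤ k<m) m<a (λ k≤r r≤m →
                                          at-distinct P i<a (≤-<-trans r≤m m<a) (<⇒≢ (<-≤-trans i<k k≤r)))) ⟩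
        not (side (p i) (q j) (p m)) ≡⟨ sym (side-swap
                                          (distinct₃ (disjoint i<a j<b) pi≢pm (≢-sym (disjoint m<a j<b)))) ⟩
        side (p i) (p m) (q j)    ≡⟨ Q-on-one-side i<a m<a (<⇒≢ (<-trans i<k k<m)) j<b ⟩
        side (p i) (p m) (q 0)    ∎
      right : orientation i m ≡ orientation k m
      right = begin
        side (p i) (p m) (q 0)    ≡⟨ sym (Q-on-one-side i<a m<a (<⇒≢ (<-trans i<k k<m)) l<b) ⟩
        side (p i) (p m) (q l)    ≡⟨ side-rotate (p i) (p m) (q l) ⟩
        side (p m) (q l) (p i)    ≡⟨ segment-side P m-uncrossed (<⇒≤ i<k) k<a (λ _ r≤k →
                                       at-distinct P m<a (≤-<-trans r≤k k<a) (≢-sym (<⇒≢ (≤-<-trans r≤k k<m)))) ⟩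
        side (p m) (q l) (p k)    ≡⟨ sym (side-rotate (p k) (p m) (q l)) ⟩
        side (p k) (p m) (q l)    ≡⟨ Q-on-one-side k<a m<a (<⇒≢ k<m) l<b ⟩
        side (p k) (p m) (q 0)    ∎

    orientation-widen : ∀ {lo i k hi} → lo ≤ i → i < k → k ≤ hi → hi < a → Exposed lo → Exposed i → Exposed hi →
                        orientation i k ≡ orientation lo hi
    orientation-widen {lo} {i} {k} {hi} lo≤i i<k k≤hi hi<a lo-exposed i-exposed hi-exposed =
      trans widen-right widen-left
      where
      widen-right : orientation i k ≡ orientation i hi
      widen-right with m≤n⇒m<n∨m≡n k≤hi
      ... | inj₁ k<hi = proj₁ (orientation-triple i<k k<hi hi<a i-exposed hi-exposed)
      ... | inj₂ refl = refl
      widen-left : orientation i hi ≡ orientation lo hi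
      widen-left with m≤n⇒m<n∨m≡n lo≤i
      ... | inj₁ lo<i = sym (proj₂ (orientation-triple lo<i (<-≤-trans i<k k≤hi) hi<a lo-exposed hi-exposed))
      ... | inj₂ refl = refl

    orientation-consistent : ∀ {i k i′ k′} → i < k → k < a → i′ < k′ → k′ < a →
                             Exposed i → Exposed k → Exposed i′ → Exposed k′ → orientation i k ≡ orientation i′ k′
    orientation-consistent {i} {k} {i′} {k′} i<k k<a i′<k′ k′<a i-exp k-exp i′-exp k′-exp =
      trans (orientation-widen (m⊓n≤m i i′) i<k (m≤m⊔n k k′) hi<a lo-exp i-exp hi-exp)
            (sym (orientation-widen (m⊓n≤n i i′) i′<k′ (m≤n⊔m k k′) hi<a lo-exp i′-exp hi-exp))
      where
      hi<a : k ⊔ k′ < a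
      hi<a = ⊔-lub k<a k′<a
      lo-exp : Exposed (i ⊓ i′)
      lo-exp = [ (λ eq → subst Exposed (sym eq) i-exp) , (λ eq → subst Exposed (sym eq) i′-exp) ]′ (⊓-sel i i′)
      hi-exp : Exposed (k ⊔ k′)
      hi-exp = [ (λ eq → subst Exposed (sym eq) k-exp) , (λ eq → subst Exposed (sym eq) k′-exp) ]′ (⊔-sel k k′)

  module Rungs {a b} (P : Path G a) (Q : Path G b) (disjoint : ∀ {i j} → i < a → j < b → at P i ≢ at Q j) where

    private
      p = at P
      q = at Q
      module PQ = Orientation P Q disjoint
      module QP = Orientation Q P (λ j<b i<a → ≢-sym (disjoint i<a j<b))

    -- Adjacency is not decidable, so the case split in ladder is on chords, whose crossings are
    -- decided by positions; rungs are special chords.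
    Free : ℕ → ℕ → Set
    Free i j = Uncrossed P (p i) (q j) × Uncrossed Q (q j) (p i)

    -- Chords p i q j and p k q l that do not cross.
    ChordPair : ℕ → ℕ → ℕ → ℕ → Set
    ChordPair i j k l = Free i j × Free k l × side (p i) (q j) (p k) ≡ side (p i) (q j) (q l)

    Parallel : Set
    Parallel = ∃ λ k → k < a × ∃ λ l → l < b × ∃ λ i → i < k × ∃ λ j → j < l × ChordPair i j k l

    Antiparallel : Set
    Antiparallel = ∃ λ k → k < a × ∃ λ j → j < b × ∃ λ i → i < k × ∃ λ l → l < j × ChordPair i j k l

    chord-pair-orientation : ∀ {i j k l} → i < a → j < b → k < a → l < b → i ≢ k → j ≢ l →
                             side (p i) (q j) (p k) ≡ side (p i) (q j) (q l) → PQ.orientation i k ≡ QP.orientation l j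
    chord-pair-orientation {i} {j} {k} {l} i<a j<b k<a l<b i≢k j≢l separated = begin
      side (p i) (p k) (q 0) ≡⟨ sym (PQ.Q-on-one-side i<a k<a i≢k j<b) ⟩
      side (p i) (p k) (q j) ≡⟨ side-across (distinct₄ (at-distinct P i<a k<a i≢k) (disjoint i<a j<b)
                                  (disjoint i<a l<b) (disjoint k<a j<b) (disjoint k<a l<b) (at-distinct Q j<b l<b j≢l))
                                  separated ⟩
      side (q l) (q j) (p i) ≡⟨ QP.Q-on-one-side l<b j<b (≢-sym j≢l) i<a ⟩
      side (q l) (q j) (p 0) ∎
      where open ≡-Reasoning

    -- Both kinds of pairs would force the orientation of P relative to Q to be its own negation.
    parallel-antiparallel : Parallel → Antiparallel → ⊥
    parallel-antiparallel (k , k<a , l , l<b , i , i<k , j , j<l , (ij-free , kl-free , separated))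
                          (k′ , k′<a , j′ , j′<b , i′ , i′<k′ , l′ , l′<j′ , (i′j′-free , k′l′-free , separated′)) =
      not-¬ refl contradictory
      where
      open ≡-Reasoning
      i<a = <-trans i<k k<a
      j<b = <-trans j<l l<b
      i′<a = <-trans i′<k′ k′<a
      l′<b = <-trans l′<j′ j′<b
      0<a = ≤-<-trans z≤n i<a
      P-consistent : PQ.orientation i k ≡ PQ.orientation i′ k′
      P-consistent = PQ.orientation-consistent i<k k<a i′<k′ k′<a
        (j , j<b , proj₁ ij-free) (l , l<b , proj₁ kl-free)
        (j′ , j′<b , proj₁ i′j′-free) (l′ , l′<b , proj₁ k′l′-free)
      Q-consistent : QP.orientation j l ≡ QP.orientation l′ j′
      Q-consistent = QP.orientation-consistent j<l l<b l′<j′ j′<b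
        (i , i<a , proj₂ ij-free) (k , k<a , proj₂ kl-free)
        (k′ , k′<a , proj₂ k′l′-free) (i′ , i′<a , proj₂ i′j′-free)
      contradictory : PQ.orientation i k ≡ not (PQ.orientation i k)
      contradictory = begin
        PQ.orientation i k         ≡⟨ chord-pair-orientation i<a j<b k<a l<b (<⇒≢ i<k) (<⇒≢ j<l) separated ⟩
        QP.orientation l j         ≡⟨ side-flip (distinct₃ (at-distinct Q j<b l<b (<⇒≢ j<l))
                                                  (≢-sym (disjoint 0<a j<b)) (≢-sym (disjoint 0<a l<b))) ⟩
        not (QP.orientation j l)   ≡⟨ cong not Q-consistent ⟩
        not (QP.orientation l′ j′) ≡⟨ cong not (sym (chord-pair-orientation i′<a j′<b k′<a l′<b
                                                         (<⇒≢ i′<k′) (≢-sym (<⇒≢ l′<j′)) separated′)) ⟩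
        not (PQ.orientation i′ k′) ≡⟨ cong not (sym P-consistent) ⟩
        not (PQ.orientation i k)   ∎

    edge-free : ∀ {i j} → i < a → j < b → Adj G (p i) (q j) → Free i j
    edge-free i<a j<b e =
      edge-uncrossed P e (λ r<a → ≢-sym (disjoint r<a j<b)) ,
      edge-uncrossed Q (adj-sym G e) (λ r<b → disjoint i<a r<b)

    edge-pair : ∀ {i j k l} → i < a → j < b → k < a → l < b → i ≢ k → j ≢ l →
                Adj G (p i) (q j) → Adj G (p k) (q l) → ChordPair i j k l
    edge-pair i<a j<b k<a l<b i≢k j≢l e f = edge-free i<a j<b e , edge-free k<a l<b f ,
      edge-side e f (distinct₄ (disjoint i<a j<b) (at-distinct P i<a k<a i≢k) (disjoint i<a l<b)
                               (≢-sym (disjoint k<a j<b)) (at-distinct Q j<b l<b j≢l) (disjoint k<a l<b))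

    parallel? : Dec Parallel
    parallel? = anyUpTo? (λ k → anyUpTo? (λ l → anyUpTo? (λ i → anyUpTo? (λ j → chord-pair? i j k l) l) k) b) a
      where
      free? : ∀ i j → Dec (Free i j)
      free? i j = Uncrossed? P (p i) (q j) ×-dec Uncrossed? Q (q j) (p i)
      chord-pair? : ∀ i j k l → Dec (ChordPair i j k l)
      chord-pair? i j k l = free? i j ×-dec free? k l ×-dec side (p i) (q j) (p k) Bool.≟ side (p i) (q j) (q l)

    ladder : Monotone G P Q ⊎ Monotone G P (reverse G Q)
    ladder with parallel?
    ... | yes parallel = inj₁ λ i<a j<b k<a l<b e f i<k → ≮⇒≥ λ l<j →
      parallel-antiparallel parallel (_ , k<a , _ , j<b , _ , i<k , _ , l<j ,
        edge-pair i<a j<b k<a l<b (<⇒≢ i<k) (≢-sym (<⇒≢ l<j)) e f)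
    ... | no ¬parallel = inj₂ λ i<a j<b k<a l<b e f i<k → ≮⇒≥ λ l<j →
      ¬parallel (_ , k<a , _ , mirror-< l<b , _ , i<k , _ , mirror-reverses l<j j<b ,
        edge-pair i<a (mirror-< j<b) k<a (mirror-< l<b) (<⇒≢ i<k) (<⇒≢ (mirror-reverses l<j j<b)) e f)
      where open Mirror b

-- Zero forcing along monotone rungs

module _ {n : ℕ} {G : Graph (Fin n)} (U : Fin n → Set) where

  P-forced : ∀ {a b} (C : TwoPathCover G a b) → let open TwoPathCover C in
             U (at P 0) → ∀ K → (∀ {i j} → i < K → i < a → j < b → Adj G (at P i) (at Q j) → InCl G U (at Q j)) →
             ∀ {r} → r ≤ K → r < a → InCl G U (at P r)
  P-forced {a} {b} C black₀ K Q-neighbours-forced r≤K r<a = forced _ r≤K r<a ≤-refl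
    where
    open TwoPathCover C
    forced : ∀ i → i ≤ K → i < a → ∀ {r} → r ≤ i → InCl G U (at P r)
    forced zero    _      _     z≤n = base black₀
    forced (suc i) 1+i≤K 1+i<a r≤1+i with m≤n⇒m<n∨m≡n r≤1+i
    ... | inj₁ r<1+i = forced i (<⇒≤ 1+i≤K) (<-trans (n<1+n i) 1+i<a) (≤-pred r<1+i)
    ... | inj₂ refl  = force (forced i (<⇒≤ 1+i≤K) i<a ≤-refl) (adjacent P 1+i<a) others
      where
      i<a = <-trans (n<1+n i) 1+i<a
      others : ∀ x → Adj G (at P i) x → x ≢ at P (suc i) → InCl G U x
      others x adj x≢next with covers x
      ... | inj₂ (j , j<b , refl) = Q-neighbours-forced 1+i≤K i<a j<b adj
      ... | inj₁ (r , r<a , refl) with P-induced i<a r<a adj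
      ...   | inj₁ refl = contradiction refl x≢next
      ...   | inj₂ refl = forced _ (<⇒≤ 1+i≤K) i<a (n≤1+n r)

  module _ {a b} (C : TwoPathCover G a b) where
    open TwoPathCover C

    module _ (monotone : Monotone G P Q) (black-p₀ : U (at P 0)) (black-q₀ : U (at Q 0)) where

      -- f is fuel for an induction on k + j.
      rung-forced : ∀ f {k j} → k + j < f → k < a → j < b → Adj G (at P k) (at Q j) →
                    (∀ {i} → i ≤ k → InCl G U (at P i)) × (∀ {l} → l ≤ j → InCl G U (at Q l))
      rung-forced (suc f) {k} {j} k+j<1+f k<a j<b e =
        (λ i≤k → P-forced C black-p₀ k P-side i≤k (≤-<-trans i≤k k<a)) ,
        (λ l≤j → P-forced (swap G C) black-q₀ j Q-side l≤j (≤-<-trans l≤j j<b))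
        where
        P-side : ∀ {i l} → i < k → i < a → l < b → Adj G (at P i) (at Q l) → InCl G U (at Q l)
        P-side i<k i<a l<b e′ = proj₂ (rung-forced f i+l<f i<a l<b e′) ≤-refl
          where i+l<f = ≤-trans (+-mono-<-≤ i<k (monotone i<a l<b k<a j<b e′ e i<k)) (≤-pred k+j<1+f)
        Q-side : ∀ {l i} → l < j → l < b → i < a → Adj G (at Q l) (at P i) → InCl G U (at P i)
        Q-side {l} {i} l<j l<b i<a e′ with k <? i
        ... | yes k<i = contradiction (monotone k<a j<b i<a l<b e (adj-sym G e′) k<i) (<⇒≱ l<j)
        ... | no k≮i  = proj₁ (rung-forced f i+l<f i<a l<b (adj-sym G e′)) ≤-refl
          where i+l<f = ≤-trans (+-mono-≤-< (≮⇒≥ k≮i) l<j) (≤-pred k+j<1+f)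

      monotone-forces : ∀ v → InCl G U v
      monotone-forces v with covers v
      ... | inj₁ (i , i<a , refl) = P-forced C black-p₀ a
              (λ _ i′<a j<b e → proj₂ (rung-forced _ ≤-refl i′<a j<b e) ≤-refl) (<⇒≤ i<a) i<a
      ... | inj₂ (j , j<b , refl) = P-forced (swap G C) black-q₀ b
              (λ _ j′<b i<a e → proj₁ (rung-forced _ ≤-refl i<a j′<b (adj-sym G e)) ≤-refl) (<⇒≤ j<b) j<b

nth : ∀ {A : Set} → A → List A → ℕ → A
nth d []       _       = d
nth d (x ∷ xs) zero    = x
nth d (x ∷ xs) (suc i) = nth d xs i

nth-lookup : ∀ {A : Set} (d : A) (xs : List A) {i} (i<len : i < length xs) → nth d xs i ≡ lookup xs (fromℕ< i<len)
nth-lookup d (x ∷ xs) {zero}  _       = refl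
nth-lookup d (x ∷ xs) {suc i} 1+i<len = nth-lookup d xs (≤-pred 1+i<len)

nth-∈ : ∀ {A : Set} (d : A) (xs : List A) {i} → i < length xs → nth d xs i ∈ xs
nth-∈ d (x ∷ xs) {zero}  _       = here refl
nth-∈ d (x ∷ xs) {suc i} 1+i<len = there (nth-∈ d xs (≤-pred 1+i<len))

∈⇒nth : ∀ {A : Set} (d : A) {xs : List A} {v} → v ∈ xs → ∃ λ i → i < length xs × nth d xs i ≡ v
∈⇒nth d (here refl) = zero , s≤s z≤n , refl
∈⇒nth d (there v∈xs) with ∈⇒nth d v∈xs
... | i , i<len , eq = suc i , s≤s i<len , eq

++-disjoint : ∀ {A : Set} (xs : List A) {ys v} → Unique (xs ++ ys) → v ∈ xs → v ∈ ys → ⊥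
++-disjoint (x ∷ xs) (x∉ ∷ _) (here refl)  v∈ys = All.lookup x∉ (∈-++⁺ʳ xs v∈ys) refl
++-disjoint (x ∷ xs) (_ ∷ u)  (there v∈xs) v∈ys = ++-disjoint xs u v∈xs v∈ys

module _ {n : ℕ} (G : Graph (Fin n)) (d : Fin n) where

  module _ (L : List (Fin n)) (L-path : IsInducedPath G L) where

    private
      unique = proj₁ (proj₂ L-path)
      adj⇔step = proj₂ (proj₂ L-path)

      at-lookup : ∀ {i} (i<len : i < length L) → nth d L i ≡ lookup L (fromℕ< i<len)
      at-lookup = nth-lookup d L

      step⇒ : ∀ {i j} (i<len : i < length L) (j<len : j < length L) → j ≡ suc i →
               toℕ (fromℕ< j<len) ≡ suc (toℕ (fromℕ< i<len))
      step⇒ i<len j<len refl = trans (toℕ-fromℕ< j<len) (cong suc (sym (toℕ-fromℕ< i<len)))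

      step⇐ : ∀ {i j} (i<len : i < length L) (j<len : j < length L) →
               toℕ (fromℕ< j<len) ≡ suc (toℕ (fromℕ< i<len)) → j ≡ suc i
      step⇐ i<len j<len eq = trans (sym (toℕ-fromℕ< j<len)) (trans eq (cong suc (toℕ-fromℕ< i<len)))

    listPath : Path G (length L)
    listPath = record
      { at        = nth d L
      ; injective = λ i<len j<len eq → fromℕ<-injective _ _ i<len j<len
                      (lookup-injective unique (trans (sym (at-lookup i<len)) (trans eq (at-lookup j<len))))
      ; adjacent  = λ {i} 1+i<len → let i<len = <-trans (n<1+n i) 1+i<len in
                      subst₂ (Adj G) (sym (at-lookup i<len)) (sym (at-lookup 1+i<len))
                        (proj₂ (adj⇔step _ _) (inj₂ (step⇒ i<len 1+i<len refl)))
      }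

    listPath-induced : Induced G listPath
    listPath-induced i<len j<len adj =
      Sum.map (step⇐ i<len j<len) (step⇐ j<len i<len) (Sum.swap
        (proj₁ (adj⇔step _ _) (subst₂ (Adj G) (at-lookup i<len) (at-lookup j<len) adj)))

  listCover : ∀ (P Q : List (Fin n)) → IsInducedPathCover G (P ∷ Q ∷ []) → TwoPathCover G (length P) (length Q)
  listCover P Q (P-path ∷ Q-path ∷ [] , unique , covered) = record
    { P = listPath P P-path ; Q = listPath Q Q-path
    ; P-induced = listPath-induced P P-path ; Q-induced = listPath-induced Q Q-path
    ; disjoint = λ i<a j<b eq →
        ++-disjoint P unique (nth-∈ d P i<a) (subst (_∈ Q ++ []) (sym eq) (∈-++⁺ˡ (nth-∈ d Q j<b)))
    ; covers = λ v → Sum.map (∈⇒nth d) (∈⇒nth d ∘ [ (λ m → m) , (λ ()) ]′ ∘ ∈-++⁻ Q) (∈-++⁻ P (covered v))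
    }

module _ {n : ℕ} (G : Graph (Fin n)) {len} (R : Path G len) (R-induced : Induced G R) where

  pathList : List (Fin n)
  pathList = applyUpTo (at R) len

  pathList-unique : Unique pathList
  pathList-unique = applyUpTo⁺₁ (at R) len λ i<j j<len → <⇒≢ i<j ∘ injective R (<-trans i<j j<len) j<len

  pathList-induced : 0 < len → IsInducedPath G pathList
  pathList-induced (s≤s z≤n) = (λ ()) , pathList-unique , λ i j → adj⇒step i j , step⇒adj i j
    where
    bound : (i : Fin (length pathList)) → toℕ i < len
    bound i = subst (toℕ i <_) (length-applyUpTo (at R) len) (toℕ<n i)
    lookup-at : ∀ i → lookup pathList i ≡ at R (toℕ i)
    lookup-at = lookup-applyUpTo (at R) len
    adj⇒step : ∀ i j → Adj G (lookup pathList i) (lookup pathList j) → toℕ i ≡ suc (toℕ j) ⊎ toℕ j ≡ suc (toℕ i)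
    adj⇒step i j adj = Sum.swap (R-induced (bound i) (bound j) (subst₂ (Adj G) (lookup-at i) (lookup-at j) adj))
    step⇒adj : ∀ i j → toℕ i ≡ suc (toℕ j) ⊎ toℕ j ≡ suc (toℕ i) → Adj G (lookup pathList i) (lookup pathList j)
    step⇒adj i j (inj₁ i≡1+j) = subst₂ (Adj G) (sym (lookup-at i)) (sym (lookup-at j))
      (adj-sym G (subst (λ r → Adj G (at R (toℕ j)) (at R r)) (sym i≡1+j)
        (adjacent R (subst (_< len) i≡1+j (bound i)))))
    step⇒adj i j (inj₂ j≡1+i) = subst₂ (Adj G) (sym (lookup-at i)) (sym (lookup-at j))
      (subst (λ r → Adj G (at R (toℕ i)) (at R r)) (sym j≡1+i) (adjacent R (subst (_< len) j≡1+i (bound j))))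

-- Upper bound

ZeroForcingSet : ∀ {V : Set} → Graph V → List V → Set
ZeroForcingSet G Z = ∀ v → InCl G (_∈ Z) v

module _ {A B : Set} (G : Graph A) (H : Graph B) (W : A × B → Set) where

  lift-closure : ∀ {U : A → Set} {g} → InCl G U g → (∀ {g′} → U g′ → ∀ y → InCl (G □ H) W (g′ , y)) →
                 ∀ y → InCl (G □ H) W (g , y)
  lift-closure (base u) fibre y = fibre u y
  lift-closure (force {u} {w} u∈cl uw others) fibre y =
    force (lift-closure u∈cl fibre y) (inj₂ (refl , uw)) others′
    where
    others′ : ∀ x → Adj (G □ H) (u , y) x → x ≢ (w , y) → InCl (G □ H) W x
    others′ (x , y′) (inj₁ (refl , _))  _      = lift-closure u∈cl fibre y′
    others′ (x , y′) (inj₂ (refl , ux)) x≢wy = lift-closure (others x ux λ x≡w → x≢wy (cong (_, y) x≡w)) fibre y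

zero-forcing×dominating : ∀ {A B : Set} (G : Graph A) (H : Graph B) {Z d} →
                          ZeroForcingSet G Z → Dominating H (d ∷ []) → PowerDominating (G □ H) (map (_, d) Z)
zero-forcing×dominating G H {Z} {d} forcing dominating (g , y) = lift-closure G H _ (forcing g) fibre y
  where
  fibre : ∀ {z} → z ∈ Z → ∀ y → InCl (G □ H) (InClosedNbhd (G □ H) (map (_, d) Z)) (z , y)
  fibre z∈Z y with dominating y
  ... | inj₁ (here refl)           = base (inj₁ (∈-map⁺ (_, d) z∈Z))
  ... | inj₂ (_ , here refl , d∼y) = base (inj₂ (_ , ∈-map⁺ (_, d) z∈Z , inj₁ (refl , d∼y)))

outerplanar-zero-forcing : ∀ {n} (G : Graph (Fin n)) → Outerplanar G → ∀ {a b} (C : TwoPathCover G a b) →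
                           0 < a → 0 < b → ∃₂ λ z₁ z₂ → z₁ ≢ z₂ × ZeroForcingSet G (z₁ ∷ z₂ ∷ [])
outerplanar-zero-forcing G (pos , pos-injective , planar) {b = b} C 0<a 0<b =
  [ forward , backward ]′ (Embedded.Rungs.ladder G pos pos-injective planar P Q disjoint)
  where
  open TwoPathCover C
  open Mirror b
  forward : Monotone G P Q → ∃₂ λ z₁ z₂ → z₁ ≢ z₂ × ZeroForcingSet G (z₁ ∷ z₂ ∷ [])
  forward monotone = _ , _ , disjoint 0<a 0<b , monotone-forces _ C monotone (here refl) (there (here refl))
  backward : Monotone G P (reverse G Q) → ∃₂ λ z₁ z₂ → z₁ ≢ z₂ × ZeroForcingSet G (z₁ ∷ z₂ ∷ [])
  backward monotone =
    _ , _ , disjoint 0<a (mirror-< 0<b) , monotone-forces _ (reverse-Q G C) monotone (here refl) (there (here refl))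

nonempty-length : ∀ {A : Set} {xs : List A} → ¬ xs ≡ [] → 0 < length xs
nonempty-length {xs = []}    xs≢[] = contradiction refl xs≢[]
nonempty-length {xs = _ ∷ _} _     = s≤s z≤n

upper-bound : ∀ {n m} (G : Graph (Fin (suc n))) (H : Graph (Fin m)) →
              Outerplanar G → PathCoverNumber G 2 → DominationNumber H 1 →
              ∃ λ S → (Unique S × PowerDominating (G □ H) S) × length S ≡ 2
upper-bound G H outerplanar
  ((P ∷ Q ∷ [] , cover@((P≢[] , _) ∷ (Q≢[] , _) ∷ [] , _) , refl) , _) ((d ∷ [] , (_ , dominating) , refl) , _)
  with outerplanar-zero-forcing G outerplanar (listCover G zero P Q cover)
         (nonempty-length P≢[]) (nonempty-length Q≢[])
... | z₁ , z₂ , z₁≢z₂ , forcing = map (_, d) (z₁ ∷ z₂ ∷ []) ,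
  (map⁺ (cong proj₁) ((z₁≢z₂ ∷ []) ∷ [] ∷ []) , zero-forcing×dominating G H forcing dominating) , refl

-- Lower bound

∃∉ : ∀ {m} (xs : List (Fin m)) → length xs < m → ∃ λ x → x ∉ xs
∃∉ {m} xs short = ¬∀⟶∃¬ m (_∈ xs) (λ x → Any.any? (x Fin.≟_) xs) λ all∈ →
  <⇒≱ short (injective⇒≤ {f = index ∘ all∈} λ {x} {y} eq →
    trans (lookup-index (all∈ x)) (trans (cong (lookup xs) eq) (sym (lookup-index (all∈ y)))))

¬¬-∀ : ∀ {k} {P : Fin k → Set} → (∀ i → ¬ ¬ P i) → ¬ ¬ (∀ i → P i)
¬¬-∀ {zero}  _     ¬all = ¬all λ ()
¬¬-∀ {suc k} ¬¬P ¬all = ¬¬P zero λ P₀ → ¬¬-∀ (¬¬P ∘ suc) λ Ps → ¬all λ { zero → P₀ ; (suc i) → Ps i }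

¬¬-decidable : ∀ {k} (P : Fin k → Set) → ¬ ¬ (∀ i → Dec (P i))
¬¬-decidable P = ¬¬-∀ λ _ → ¬¬-excluded-middle

¬¬-decidable₂ : ∀ {k} (R : Fin k → Fin k → Set) → ¬ ¬ (∀ i j → Dec (R i j))
¬¬-decidable₂ R = ¬¬-∀ λ i → ¬¬-decidable (R i)

module _ {n : ℕ} (G : Graph (Fin n)) (adj? : ∀ u v → Dec (Adj G u v)) (g : Fin n) where

  -- The vertices x 0 = g, …, x k forced one after another from {g}: x s forced x (suc s), so its
  -- other neighbours were already black.
  record ForcingChain (k : ℕ) : Set where
    field
      path      : Path G (suc k)
      starts    : at path 0 ≡ g
      saturated : ∀ {s} → s < k → ∀ {y} → Adj G (at path s) y → ∃ λ r → r ≤ suc s × at path r ≡ y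

  module _ {k} (c : ForcingChain k) where
    open ForcingChain c

    last : Fin n
    last = at path k

    InChain : Fin n → Set
    InChain y = ∃ λ r → r < suc k × at path r ≡ y

    inChain? : ∀ y → Dec (InChain y)
    inChain? y = anyUpTo? (λ r → at path r Fin.≟ y) (suc k)

    Stuck : Set
    Stuck = ¬ (∃ λ y → Adj G last y × ¬ InChain y × (∀ {y′} → Adj G last y′ → ¬ InChain y′ → y′ ≡ y))

    saturated-next : ∀ {i j} → i < j → j < suc k → Adj G (at path i) (at path j) → j ≡ suc i
    saturated-next i<j j<1+k adj with saturated (<-≤-trans i<j (≤-pred j<1+k)) adj
    ... | r , r≤1+i , xr≡xj =
      ≤-antisym (subst (_≤ _) (injective path (≤-<-trans (≤-trans r≤1+i i<j) j<1+k) j<1+k xr≡xj) r≤1+i) i<j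

    chain-induced : Induced G path
    chain-induced {i} {j} i<1+k j<1+k adj with <-cmp i j
    ... | tri< i<j _ _  = inj₁ (saturated-next i<j j<1+k adj)
    ... | tri≈ _ refl _ = ⊥-elim (adj-irrefl G adj)
    ... | tri> _ _ j<i  = inj₂ (saturated-next j<i i<1+k (adj-sym G adj))

    module _ {y} (xy : Adj G last y) (y∉ : ¬ InChain y) where

      private
        at′ : ℕ → Fin n
        at′ i with i ≤? k
        ... | yes _ = at path i
        ... | no  _ = y

        at′-old : ∀ {i} → i ≤ k → at′ i ≡ at path i
        at′-old {i} i≤k with i ≤? k
        ... | yes _   = refl
        ... | no  i≰k = contradiction i≤k i≰k

        at′-new : at′ (suc k) ≡ y
        at′-new with suc k ≤? k
        ... | yes 1+k≤k = contradiction 1+k≤k 1+n≰n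
        ... | no  _     = refl

        old-or-new : ∀ {i} → i < suc (suc k) → i ≤ k ⊎ i ≡ suc k
        old-or-new i<2+k = Sum.map₁ ≤-pred (m≤n⇒m<n∨m≡n (≤-pred i<2+k))

        at′-new-fresh : ∀ {i} → i ≤ k → at′ i ≢ at′ (suc k)
        at′-new-fresh i≤k eq = y∉ (_ , s≤s i≤k , trans (sym (at′-old i≤k)) (trans eq at′-new))

      extend : (∀ {y′} → Adj G last y′ → ¬ InChain y′ → y′ ≡ y) → ForcingChain (suc k)
      extend unique = record
        { path      = record { at = at′ ; injective = injective′ ; adjacent = adjacent′ }
        ; starts    = trans (at′-old z≤n) starts
        ; saturated = saturated′
        }
        where
        injective′ : ∀ {i j} → i < suc (suc k) → j < suc (suc k) → at′ i ≡ at′ j → i ≡ j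
        injective′ i<2+k j<2+k eq with old-or-new i<2+k | old-or-new j<2+k
        ... | inj₁ i≤k  | inj₁ j≤k  =
          injective path (s≤s i≤k) (s≤s j≤k) (trans (sym (at′-old i≤k)) (trans eq (at′-old j≤k)))
        ... | inj₁ i≤k  | inj₂ refl = contradiction eq (at′-new-fresh i≤k)
        ... | inj₂ refl | inj₁ j≤k  = contradiction (sym eq) (at′-new-fresh j≤k)
        ... | inj₂ refl | inj₂ refl = refl
        adjacent′ : ∀ {i} → suc i < suc (suc k) → Adj G (at′ i) (at′ (suc i))
        adjacent′ {i} 1+i<2+k with old-or-new 1+i<2+k
        ... | inj₁ 1+i≤k =
          subst₂ (Adj G) (sym (at′-old (<⇒≤ 1+i≤k))) (sym (at′-old 1+i≤k)) (adjacent path (s≤s 1+i≤k))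
        ... | inj₂ refl  = subst₂ (Adj G) (sym (at′-old ≤-refl)) (sym at′-new) xy
        saturated′ : ∀ {s} → s < suc k → ∀ {y′} → Adj G (at′ s) y′ → ∃ λ r → r ≤ suc s × at′ r ≡ y′
        saturated′ {s} s<1+k {y′} adj with m≤n⇒m<n∨m≡n (≤-pred s<1+k)
        ... | inj₁ s<k with saturated s<k (subst (λ v → Adj G v y′) (at′-old (<⇒≤ s<k)) adj)
        ...   | r , r≤1+s , eq = r , r≤1+s , trans (at′-old (≤-trans r≤1+s s<k)) eq
        saturated′ {s} s<1+k {y′} adj | inj₂ refl with inChain? y′
        ...   | yes (r , r<1+k , eq) = r , m≤n⇒m≤1+n (≤-pred r<1+k) , trans (at′-old (≤-pred r<1+k)) eq
        ...   | no  y′∉ =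
          suc k , ≤-refl , trans at′-new (sym (unique (subst (λ v → Adj G v y′) (at′-old ≤-refl) adj) y′∉))

  start : ForcingChain 0
  start = record
    { path      = record { at = λ _ → g ; injective = λ { (s≤s z≤n) (s≤s z≤n) _ → refl } ; adjacent = λ { (s≤s ()) } }
    ; starts    = refl
    ; saturated = λ ()
    }

  chain-bounded : ∀ {k} → ForcingChain k → suc k ≤ n
  chain-bounded {k} c = injective⇒≤ {f = at path ∘ toℕ} λ eq → toℕ-injective (injective path (toℕ<n _) (toℕ<n _) eq)
    where open ForcingChain c

  -- A chain has at most n vertices, so n steps of fuel suffice.
  stuck-chain : ∀ fuel {k} → ForcingChain k → n ≤ k + fuel → ∃ λ K → Σ (ForcingChain K) Stuck
  stuck-chain zero {k} c n≤k+0 = contradiction (≤-trans (chain-bounded c) (subst (n ≤_) (+-identityʳ k) n≤k+0)) 1+n≰n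
  stuck-chain (suc fuel) {k} c n≤k+1+f with any? (λ y → adj? (last c) y ×-dec ¬? (inChain? c y))
  ... | no  none = k , c , λ (y , xy , y∉ , _) → none (y , xy , y∉)
  ... | yes (y , xy , y∉) with any? (λ y′ → adj? (last c) y′ ×-dec ¬? (inChain? c y′) ×-dec ¬? (y′ Fin.≟ y))
  ...   | yes (y′ , xy′ , y′∉ , y′≢y) =
    k , c , λ (_ , _ , _ , unique) → y′≢y (trans (unique xy′ y′∉) (sym (unique xy y∉)))
  ...   | no  no-other = stuck-chain fuel (extend c xy y∉ unique) (subst (n ≤_) (+-suc k fuel) n≤k+1+f)
    where
    unique : ∀ {y′} → Adj G (last c) y′ → ¬ InChain c y′ → y′ ≡ y
    unique {y′} xy′ y′∉ with y′ Fin.≟ y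
    ... | yes eq   = eq
    ... | no  y′≢y = contradiction (y′ , xy′ , y′∉ , y′≢y) no-other

  stuck-closure : ∀ {K} (c : ForcingChain K) → Stuck c → ∀ {v} → InCl G (_∈ (g ∷ [])) v → InChain c v
  stuck-closure c stuck (base (here refl)) = 0 , s≤s z≤n , ForcingChain.starts c
  stuck-closure {K} c stuck (force {u} {w} u∈cl uw others) with inChain? c w | stuck-closure c stuck u∈cl
  ... | yes w∈ | _ = w∈
  ... | no  w∉ | s , s<1+K , refl with m≤n⇒m<n∨m≡n (≤-pred s<1+K)
  ...   | inj₁ s<K = let (r , r≤1+s , eq) = ForcingChain.saturated c s<K uw in
                     contradiction (r , s≤s (≤-trans r≤1+s s<K) , eq) w∉
  ...   | inj₂ refl = contradiction (w , uw , w∉ , λ {y′} → unique {y′}) stuck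
    where
    unique : ∀ {y′} → Adj G u y′ → ¬ InChain c y′ → y′ ≡ w
    unique {y′} uy′ y′∉ with y′ Fin.≟ w
    ... | yes eq   = eq
    ... | no  y′≢w = contradiction (stuck-closure c stuck (others y′ uy′ y′≢w)) y′∉

  single-zero-forcing-path : ZeroForcingSet G (g ∷ []) → ∃ λ L → IsInducedPathCover G (L ∷ [])
  single-zero-forcing-path forcing with stuck-chain n start ≤-refl
  ... | K , c , stuck = pathList G path (chain-induced c) ,
    (pathList-induced G path (chain-induced c) (s≤s z≤n) ∷ []) ,
    subst Unique (sym (++-identityʳ _)) (pathList-unique G path (chain-induced c)) ,
    λ v → subst (v ∈_) (sym (++-identityʳ _)) (covered v)
    where
    open ForcingChain c
    covered : ∀ v → v ∈ pathList G path (chain-induced c)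
    covered v with stuck-closure c stuck (forcing v)
    ... | r , r<1+K , refl = ∈-applyUpTo⁺ (at path) r<1+K

  no-single-zero-forcing-vertex : (∀ ps → IsInducedPathCover G ps → 2 ≤ length ps) → ¬ ZeroForcingSet G (g ∷ [])
  no-single-zero-forcing-vertex minimal forcing with single-zero-forcing-path forcing
  ... | L , cover = contradiction (minimal (L ∷ []) cover) λ { (s≤s ()) }

module _ {m : ℕ} (H : Graph (Fin m)) (4≤m : 4 ≤ m) {d : Fin m} (dominating : Dominating H (d ∷ [])) (h : Fin m) where

  private
    d-adjacent : ∀ {x} → x ≢ d → Adj H d x
    d-adjacent {x} x≢d with dominating x
    ... | inj₁ (here x≡d)          = contradiction x≡d x≢d
    ... | inj₂ (_ , here refl , dx) = dx

  Confined : Fin m → Set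
  Confined v = v ≡ h ⊎ (v ≡ d × ∀ {x} → Adj H h x → x ≡ d)

  d-cannot-force : ∀ {w} → (∀ x → Adj H d x → x ≢ w → Confined x) → ⊥
  d-cannot-force {w} confined-others with ∃∉ (d ∷ h ∷ w ∷ []) 4≤m
  ... | x , x∉ with confined-others x (d-adjacent (x∉ ∘ here)) (x∉ ∘ there ∘ there ∘ here)
  ...   | inj₁ x≡h       = x∉ (there (here x≡h))
  ...   | inj₂ (x≡d , _) = x∉ (here x≡d)

  confined : ∀ {v} → InCl H (_∈ (h ∷ [])) v → Confined v
  confined (base (here refl)) = inj₁ refl
  confined (force {u} {w} u∈cl uw others) with confined u∈cl
  ... | inj₂ (refl , _) = ⊥-elim (d-cannot-force λ x ux x≢w → confined (others x ux x≢w))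
  ... | inj₁ refl with h Fin.≟ d | w Fin.≟ d
  ...   | yes refl | _       = ⊥-elim (d-cannot-force λ x ux x≢w → confined (others x ux x≢w))
  ...   | no  h≢d  | yes refl = inj₂ (refl , only-d)
    where
    only-d : ∀ {x} → Adj H h x → x ≡ d
    only-d {x} hx with x Fin.≟ d
    ... | yes x≡d = x≡d
    ... | no  x≢d with confined (others x hx x≢d)
    ...   | inj₁ refl      = ⊥-elim (adj-irrefl H hx)
    ...   | inj₂ (x≡d , _) = contradiction x≡d x≢d
  ...   | no  h≢d  | no  w≢d with confined (others d (adj-sym H (d-adjacent h≢d)) (w≢d ∘ sym))
  ...     | inj₁ d≡h         = contradiction (sym d≡h) h≢d
  ...     | inj₂ (_ , only-d) = contradiction (only-d uw) w≢d

  dominated-no-single-zero-forcing-vertex : ¬ ZeroForcingSet H (h ∷ [])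
  dominated-no-single-zero-forcing-vertex forcing with ∃∉ (h ∷ d ∷ []) (≤-trans (n≤1+n 3) 4≤m)
  ... | y , y∉ with confined (forcing y)
  ...   | inj₁ y≡h       = y∉ (here y≡h)
  ...   | inj₂ (y≡d , _) = y∉ (there (here y≡d))

module _ {k : ℕ} (X : Graph (Fin k)) (adj? : ∀ u v → Dec (Adj X u v))
         {U : Fin k → Set} (cl? : ∀ v → Dec (InCl X U v)) where

  closure-complement-fort : ∀ {u w} → InCl X U u → ¬ InCl X U w → Adj X u w → ∃ λ x → Adj X u x × ¬ InCl X U x × x ≢ w
  closure-complement-fort {u} {w} u∈cl w∉cl uw with any? (λ x → adj? u x ×-dec ¬? (cl? x) ×-dec ¬? (x Fin.≟ w))
  ... | yes found = found
  ... | no  none  = contradiction (force u∈cl uw others) w∉cl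
    where
    others : ∀ x → Adj X u x → x ≢ w → InCl X U x
    others x ux x≢w with cl? x
    ... | yes x∈cl = x∈cl
    ... | no  x∉cl = contradiction (x , ux , x∉cl , x≢w) none

module _ {n m : ℕ} (G : Graph (Fin n)) (H : Graph (Fin m))
         (adjG? : ∀ u v → Dec (Adj G u v)) (adjH? : ∀ u v → Dec (Adj H u v))
         {U : Fin n → Set} {V : Fin m → Set} (clG? : ∀ g → Dec (InCl G U g)) (clH? : ∀ h → Dec (InCl H V h)) where

  □-closure : ∀ {W} → (∀ {v} → W v → U (proj₁ v) ⊎ V (proj₂ v)) →
              ∀ {v} → InCl (G □ H) W v → InCl G U (proj₁ v) ⊎ InCl H V (proj₂ v)
  □-closure W⊆ (base w) = Sum.map base base (W⊆ w)
  □-closure W⊆ (force {u₁ , u₂} {w₁ , w₂} u∈cl uw others) with clG? w₁ | clH? w₂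
  ... | yes w₁∈cl | _         = inj₁ w₁∈cl
  ... | no  _     | yes w₂∈cl = inj₂ w₂∈cl
  ... | no  w₁∉cl | no  w₂∉cl = ⊥-elim (blocked uw (□-closure W⊆ u∈cl))
    where
    blocked : Adj (G □ H) (u₁ , u₂) (w₁ , w₂) → InCl G U u₁ ⊎ InCl H V u₂ → ⊥
    blocked (inj₁ (refl , _))     (inj₁ u₁∈cl) = w₁∉cl u₁∈cl
    blocked (inj₁ (refl , u₂w₂)) (inj₂ u₂∈cl) with closure-complement-fort H adjH? clH? u₂∈cl w₂∉cl u₂w₂
    ... | x , u₂x , x∉cl , x≢w₂ =
      [ w₁∉cl , x∉cl ]′ (□-closure W⊆ (others (u₁ , x) (inj₁ (refl , u₂x)) (x≢w₂ ∘ cong proj₂)))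
    blocked (inj₂ (refl , _))     (inj₂ u₂∈cl) = w₂∉cl u₂∈cl
    blocked (inj₂ (refl , u₁w₁)) (inj₁ u₁∈cl) with closure-complement-fort G adjG? clG? u₁∈cl w₁∉cl u₁w₁
    ... | x , u₁x , x∉cl , x≢w₁ =
      [ x∉cl , w₂∉cl ]′ (□-closure W⊆ (others (x , u₂) (inj₂ (refl , u₁x)) (x≢w₁ ∘ cong proj₁)))

closure-of-∅ : ∀ {A : Set} (X : Graph A) {v} → ¬ InCl X (InClosedNbhd X []) v
closure-of-∅ X (base (inj₁ ()))
closure-of-∅ X (base (inj₂ (_ , () , _)))
closure-of-∅ X (force u∈cl _ _) = closure-of-∅ X u∈cl

neighbourhood-of-vertex : ∀ {A B : Set} (G : Graph A) (H : Graph B) {g h v} →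
                          InClosedNbhd (G □ H) ((g , h) ∷ []) v → proj₁ v ∈ (g ∷ []) ⊎ proj₂ v ∈ (h ∷ [])
neighbourhood-of-vertex G H (inj₁ (here refl))                        = inj₁ (here refl)
neighbourhood-of-vertex G H (inj₂ (_ , here refl , inj₁ (refl , _))) = inj₁ (here refl)
neighbourhood-of-vertex G H (inj₂ (_ , here refl , inj₂ (refl , _))) = inj₂ (here refl)

single-vertex-not-power-dominating : ∀ {n m} (G : Graph (Fin n)) (H : Graph (Fin m)) → 4 ≤ m →
  PathCoverNumber G 2 → DominationNumber H 1 → ∀ {g h} → ¬ PowerDominating (G □ H) ((g , h) ∷ [])
single-vertex-not-power-dominating {n} {m} G H 4≤m (_ , minimal) ((d ∷ [] , (_ , dominating) , refl) , _) {g} {h} pd =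
  ¬¬-decidable₂ (Adj G) λ adjG? → ¬¬-decidable₂ (Adj H) λ adjH? →
  ¬¬-decidable (InCl G (_∈ (g ∷ []))) λ clG? → ¬¬-decidable (InCl H (_∈ (h ∷ []))) λ clH? →
  let (a , a∉cl) = ¬∀⟶∃¬ n _ clG? (no-single-zero-forcing-vertex G adjG? g minimal)
      (b , b∉cl) = ¬∀⟶∃¬ m _ clH? (dominated-no-single-zero-forcing-vertex H 4≤m dominating h)
  in [ a∉cl , b∉cl ]′ (□-closure G H adjG? adjH? clG? clH? (neighbourhood-of-vertex G H) (pd (a , b)))

lower-bound : ∀ {n m} (G : Graph (Fin (suc n))) (H : Graph (Fin m)) →
              4 ≤ m → PathCoverNumber G 2 → DominationNumber H 1 →
              ∀ S → Unique S × PowerDominating (G □ H) S → 2 ≤ length S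
lower-bound G H (s≤s _) _ _ [] (_ , pd) = ⊥-elim (closure-of-∅ (G □ H) (pd (zero , zero)))
lower-bound G H 4≤m cover domination (_ ∷ []) (_ , pd) =
  ⊥-elim (single-vertex-not-power-dominating G H 4≤m cover domination pd)
lower-bound G H _ _ _ (_ ∷ _ ∷ _) _ = s≤s (s≤s z≤n)

mainTheorem11 : ∀ {n m} (G : Graph (Fin n)) (H : Graph (Fin m)) →
                  4 ≤ n → 4 ≤ m → Connected G → Connected H →
                  Outerplanar G → PathCoverNumber G 2 → DominationNumber H 1 →
                  PowerDominationNumber (G □ H) 2
mainTheorem11 G H (s≤s _) 4≤m _ _ outerplanar cover domination =
  upper-bound G H outerplanar cover domination , lower-bound G H 4≤m cover domination
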